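{- Let $n,k$ be positive integers and let $f$ be a valid $(n,k)$-code. Then $\phi_{\leftarrow}(\phi_{\rightarrow}(f))=f$.
   Context: An $(n,k)$-code is a function $f:\{1,\dots,n\}\to\mathbb{Z}_{\ge 0}$ with $\sum_i f(i)=k$; write $f_i=f(i)$ and index positions cyclically in $\mathbb{Z}_n$. A cyclic interval $[i,j]$ is $\{i,i+1,\dots,j\}$ taken in $\mathbb{Z}_n$. Let $m_f=\max_{i\in\mathbb{Z}_n}(f_i+f_{i+1})$. The code is invalid if $f_i+f_{i+1}=m_f$ for all $i$, valid otherwise. A slime of $f$ is a cyclic interval $[i,j]$ of size $l$ with $2\le l\le n$ such that $f_r+f_{r+1}=m_f$ for $r=i,i+1,\dots,j-1$, while $f_{i-1}+f_i<m_f$ and $f_j+f_{j+1}<m_f$. (Distinct slimes are disjoint; on a slime the entries alternate $a,b,a,b,\dots$ with $a+b=m_f$.) Forward move on a slime $[i,j]$ of size $l$: if $l$ is even, subtract $1$ from the entries at positions $i,i+2,\dots,j-1$ and add $1$ to those at positions $i+1,i+3,\dots,j$ (so $a,b,\dots,a,b$ becomes $a-1,b+1,\dots,a-1,b+1$); if $l$ is odd, leave position $i$ unchanged, subtract $1$ at positions $i+1,i+3,\dots,j-1$ and add $1$ at positions $i+2,i+4,\dots,j$ (so $a,b,\dots,b,a$ becomes $a,b-1,a+1,\dots,b-1,a+1$). Backward move on a slime $[i,j]$ of size $l$: if $l$ is even, add $1$ at positions $i,i+2,\dots,j-1$ and subtract $1$ at positions $i+1,\dots,j$ (giving $a+1,b-1,\dots,a+1,b-1$);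 if $l$ is odd, add $1$ at positions $i,i+2,\dots,j-2$, subtract $1$ at positions $i+1,\dots,j-1$ and leave position $j$ unchanged (giving $a+1,b-1,\dots,a+1,b-1,a$). $\phi_{\rightarrow}(f)$ (forward migration) is the code obtained from $f$ by performing the forward move on all slimes of $f$ simultaneously; $\phi_{\leftarrow}(f)$ (backward migration) is obtained by performing the backward move on all slimes of $f$ simultaneously. -}

module Defs where

open import Data.Nat using (ℕ; zero; suc; _+_; _∸_; _≤_; _<_; _⊔_; NonZero; _≟_; _≤?_; _<?_)
open import Data.Nat.DivMod using (_%_; m%n<n)
open import Data.Fin using (Fin; toℕ; fromℕ<)
open import Data.Fin.Properties using (all?)
open import Data.List using (List; map; foldr; allFin)
open import Data.Nat.ListAction using (sum)
open import Data.Product using (_×_)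
open import Data.Bool using (Bool; true; false; if_then_else_; _∧_)
open import Relation.Nullary using (Dec; does; ¬_)
open import Relation.Nullary.Decidable using (_×-dec_)
open import Relation.Binary.PropositionalEquality using (_≡_)

-- An (n,k)-code is f : Fin n → ℕ (positions 0..n-1, i.e. 1..n shifted)
-- with sum f ≡ k.
codeSum : {n : ℕ} → (Fin n → ℕ) → ℕ
codeSum {n} f = sum (map f (allFin n))

even : ℕ → Bool
even zero = true
even (suc zero) = false
even (suc (suc r)) = even r

data Eff : Set where
  inc dec keep : Eff

data Dir : Set where
  fwd bwd : Dir

-- eff d l r : effect of the (forward/backward) move on a slime of size l
-- at the position with offset r (0 ≤ r < l) from the slime's start i.
eff : Dir → ℕ → ℕ → Eff
eff fwd l r = if even l
  then (if even r then dec else inc)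
  else (if even r then (if r Data.Nat.≡ᵇ 0 then keep else inc) else dec)
eff bwd l r = if even l
  then (if even r then inc else dec)
  else (if r Data.Nat.≡ᵇ (l ∸ 1) then keep else (if even r then inc else dec))

isInc : Eff → Bool
isInc inc = true
isInc _ = false

isDec : Eff → Bool
isDec dec = true
isDec _ = false

module _ {n : ℕ} {{nz : NonZero n}} where

  pos : ℕ → Fin n
  pos x = fromℕ< (m%n<n x n)

  pairSum : (Fin n → ℕ) → ℕ → ℕ
  pairSum f x = f (pos x) + f (pos (suc x))

  mx : (Fin n → ℕ) → ℕ
  mx f = foldr _⊔_ 0 (map (λ i → pairSum f (toℕ i)) (allFin n))

  Invalid : (Fin n → ℕ) → Set
  Invalid f = (i : Fin n) → pairSum f (toℕ i) ≡ mx f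

  Valid : (Fin n → ℕ) → Set
  Valid f = ¬ Invalid f

  -- [i, i+l-1] (cyclic) is a slime of f of size l.
  -- Position i-1 is i + (n-1), position j = i + (l-1), j+1 = i + l.
  IsSlime : (Fin n → ℕ) → Fin n → ℕ → Set
  IsSlime f i l =
    (2 ≤ l) × (l ≤ n)
    × ((r : Fin (l ∸ 1)) → pairSum f (toℕ i + toℕ r) ≡ mx f)
    × (pairSum f (toℕ i + (n ∸ 1)) < mx f)
    × (pairSum f (toℕ i + (l ∸ 1)) < mx f)

  isSlime? : (f : Fin n → ℕ) (i : Fin n) (l : ℕ) → Dec (IsSlime f i l)
  isSlime? f i l =
    (2 ≤? l) ×-dec (l ≤? n)
    ×-dec all? (λ r → pairSum f (toℕ i + toℕ r) ≟ mx f)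
    ×-dec (pairSum f (toℕ i + (n ∸ 1)) <? mx f)
    ×-dec (pairSum f (toℕ i + (l ∸ 1)) <? mx f)

  offset : Fin n → Fin n → ℕ
  offset i p = (toℕ p + (n ∸ toℕ i)) % n

  hit : Dir → (Eff → Bool) → (Fin n → ℕ) → Fin n → ℕ → Fin n → ℕ
  hit d e f i l p =
    if does (isSlime? f i l) ∧ does (offset i p <? l) ∧ e (eff d l (offset i p))
    then 1 else 0

  -- total number of slimes (over all starts i and sizes l ≤ n) whose move
  -- has effect e at p (at most one slime contains p, slimes being disjoint)
  count : Dir → (Eff → Bool) → (Fin n → ℕ) → Fin n → ℕ
  count d e f p =
    sum (map (λ i → sum (map (λ l → hit d e f i (toℕ l) p) (allFin (suc n)))) (allFin n))

  -- all slime moves performed simultaneously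
  migrate : Dir → (Fin n → ℕ) → (Fin n → ℕ)
  migrate d f p = (f p + count d isInc f p) ∸ count d isDec f p

  φ→ : (Fin n → ℕ) → (Fin n → ℕ)
  φ→ = migrate fwd

  φ← : (Fin n → ℕ) → (Fin n → ℕ)
  φ← = migrate bwd

-- Write g = φ→ f and m = m_f.  On each slime of f the forward move changes exactly an
-- even-length block (the whole slime, or all but its first entry when the length is odd),
-- decrementing at even and incrementing at odd block offsets.  The decremented entries are
-- positive: they all equal the last one, which exceeds the entry after the slime.  Hence the
-- pair sums inside a block stay m, all other pair sums of g stay at most m, and m_g = m.
-- Each block therefore starts a slime of g: the block itself, or the block followed by the
-- next entry when that pair also reaches m, an odd slime whose backward move leaves its last
-- entry alone.  The backward move undoes the forward move on every block, and every other
-- position is fixed by φ→ and meets a slime of g at most as such an untouched last entry.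
-- Validity is what guarantees that every maximal pair lies in a slime.

module Submission where

open import Defs
open import Data.Bool using (Bool; true; false; not; if_then_else_; _∧_)
open import Data.Bool.Properties using (not-injective)
open import Data.Empty using (⊥; ⊥-elim)
open import Data.Fin using (Fin; toℕ; fromℕ<) renaming (zero to fzero; suc to fsuc)
open import Data.Fin.Properties using (toℕ-fromℕ<; toℕ-injective; toℕ<n; ¬∀⟶∃¬) renaming (suc-injective to fsuc-injective)
open import Data.List using (map; foldr; allFin; tabulate)
open import Data.List.Properties using (map-tabulate)
open import Data.Nat using (ℕ; zero; suc; _+_; _∸_; _≤_; _<_; _⊔_; z≤n; s≤s; s≤s⁻¹; NonZero; _≟_; _<?_; _≡ᵇ_)
open import Data.Nat.DivMod using (_%_; m%n<n; %-distribˡ-+; [m+n]%n≡m%n; m<n⇒m%n≡m; m%n%n≡m%n)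
open import Data.Nat.ListAction using (sum)
open import Data.Nat.Properties
open import Data.Product using (_×_; _,_; proj₁; proj₂; Σ; ∃)
open import Data.Sum using (_⊎_; inj₁; inj₂)
open import Function using (_∘_)
open import Relation.Binary using (tri<; tri≈; tri>)
open import Relation.Binary.PropositionalEquality
open import Relation.Nullary using (Dec; yes; no; does; ¬_)

-- Sums, maxima and searches

sum-tabulate-≡0 : ∀ {m} (F : Fin m → ℕ) → (∀ j → F j ≡ 0) → sum (tabulate F) ≡ 0
sum-tabulate-≡0 {zero}  F F≡0 = refl
sum-tabulate-≡0 {suc m} F F≡0 = cong₂ _+_ (F≡0 fzero) (sum-tabulate-≡0 (λ j → F (fsuc j)) (λ j → F≡0 (fsuc j)))

sum-tabulate-single : ∀ {m} (F : Fin m → ℕ) j₀ → (∀ j → j ≢ j₀ → F j ≡ 0) → sum (tabulate F) ≡ F j₀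
sum-tabulate-single {suc m} F fzero F≡0 =
  trans (cong (F fzero +_) (sum-tabulate-≡0 _ (λ j → F≡0 (fsuc j) (λ ())))) (+-identityʳ _)
sum-tabulate-single {suc m} F (fsuc j₀) F≡0 =
  cong₂ _+_ (F≡0 fzero (λ ()))
            (sum-tabulate-single (λ j → F (fsuc j)) j₀ (λ j j≢j₀ → F≡0 (fsuc j) (j≢j₀ ∘ fsuc-injective)))

sum-allFin-≡0 : ∀ {m} (F : Fin m → ℕ) → (∀ j → F j ≡ 0) → sum (map F (allFin m)) ≡ 0
sum-allFin-≡0 F F≡0 = trans (cong sum (map-tabulate (λ j → j) F)) (sum-tabulate-≡0 F F≡0)

sum-allFin-single : ∀ {m} (F : Fin m → ℕ) j₀ → (∀ j → j ≢ j₀ → F j ≡ 0) → sum (map F (allFin m)) ≡ F j₀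
sum-allFin-single F j₀ F≡0 = trans (cong sum (map-tabulate (λ j → j) F)) (sum-tabulate-single F j₀ F≡0)

foldr-⊔-upper : ∀ {m} (F : Fin m → ℕ) j → F j ≤ foldr _⊔_ 0 (tabulate F)
foldr-⊔-upper F fzero    = m≤m⊔n _ _
foldr-⊔-upper F (fsuc j) = ≤-trans (foldr-⊔-upper (λ x → F (fsuc x)) j) (m≤n⊔m (F fzero) _)

foldr-⊔-lub : ∀ {m} (F : Fin m → ℕ) {M} → (∀ j → F j ≤ M) → foldr _⊔_ 0 (tabulate F) ≤ M
foldr-⊔-lub {zero}  F F≤M = z≤n
foldr-⊔-lub {suc m} F F≤M = ⊔-lub (F≤M fzero) (foldr-⊔-lub (λ x → F (fsuc x)) (λ j → F≤M (fsuc j)))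

foldr-⊔-attained : ∀ {m} (F : Fin m → ℕ) → foldr _⊔_ 0 (tabulate F) ≡ 0 ⊎ ∃ λ j → F j ≡ foldr _⊔_ 0 (tabulate F)
foldr-⊔-attained {zero}  F = inj₁ refl
foldr-⊔-attained {suc m} F with ≤-total (F fzero) (foldr _⊔_ 0 (tabulate (λ x → F (fsuc x))))
... | inj₂ F₀≥ = inj₂ (fzero , sym (m≥n⇒m⊔n≡m F₀≥))
... | inj₁ F₀≤ with foldr-⊔-attained (λ x → F (fsuc x))
...   | inj₁ ≡0       = inj₁ (trans (m≤n⇒m⊔n≡n F₀≤) ≡0)
...   | inj₂ (j , Fj) = inj₂ (fsuc j , trans Fj (sym (m≤n⇒m⊔n≡n F₀≤)))

module Search (Q : ℕ → Set) (Q? : ∀ t → Dec (Q t)) where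

  lastBefore : ∀ u → Q 0 → Σ ℕ λ t → t ≤ u × Q t × (∀ t′ → t < t′ → t′ ≤ u → ¬ Q t′)
  lastBefore zero    q₀ = 0 , z≤n , q₀ , λ t′ 0<t′ t′≤0 → ⊥-elim (<⇒≱ 0<t′ t′≤0)
  lastBefore (suc u) q₀ with Q? (suc u)
  ... | yes q = suc u , ≤-refl , q , λ t′ u<t′ t′≤u → ⊥-elim (<⇒≱ u<t′ t′≤u)
  ... | no ¬q with lastBefore u q₀
  ...   | t , t≤u , qt , none = t , m≤n⇒m≤1+n t≤u , qt , none′
    where
    none′ : ∀ t′ → t < t′ → t′ ≤ suc u → ¬ Q t′
    none′ t′ t<t′ t′≤1+u with m≤n⇒m<n∨m≡n t′≤1+u
    ... | inj₁ t′<1+u = none t′ t<t′ (s≤s⁻¹ t′<1+u)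
    ... | inj₂ refl   = ¬q

  firstFrom : ∀ k u → Q (u + k) →
              Σ ℕ λ t → u ≤ t × t ≤ u + k × Q t × (∀ t′ → u ≤ t′ → t′ < t → ¬ Q t′)
  firstFrom zero u q =
    u , ≤-refl , m≤m+n u 0 , subst Q (+-identityʳ u) q , λ t′ u≤t′ t′<u → ⊥-elim (<⇒≱ t′<u u≤t′)
  firstFrom (suc k) u q with Q? u
  ... | yes qu = u , ≤-refl , m≤m+n u (suc k) , qu , λ t′ u≤t′ t′<u → ⊥-elim (<⇒≱ t′<u u≤t′)
  ... | no ¬qu with firstFrom k (suc u) (subst Q (+-suc u k) q)
  ...   | t , 1+u≤t , t≤ , qt , none = t , <⇒≤ 1+u≤t , ≤-trans t≤ (≤-reflexive (sym (+-suc u k))) , qt , none′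
    where
    none′ : ∀ t′ → u ≤ t′ → t′ < t → ¬ Q t′
    none′ t′ u≤t′ t′<t with m≤n⇒m<n∨m≡n u≤t′
    ... | inj₁ u<t′ = none t′ u<t′ t′<t
    ... | inj₂ refl = ¬qu

-- Moves, parity and blocks

apply : Eff → ℕ → ℕ
apply inc x  = suc x
apply dec x  = x ∸ 1
apply keep x = x

indicator : Bool → ℕ
indicator b = if b then 1 else 0

apply-indicators : ∀ e x → (x + indicator (isInc e)) ∸ indicator (isDec e) ≡ apply e x
apply-indicators inc x  = +-comm x 1
apply-indicators dec x  = cong (_∸ 1) (+-identityʳ x)
apply-indicators keep x = +-identityʳ x

apply≤suc : ∀ e x → apply e x ≤ suc x
apply≤suc inc x  = ≤-refl
apply≤suc dec x  = ≤-trans (m∸n≤m x 1) (n≤1+n x)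
apply≤suc keep x = n≤1+n x

indicator-dec-∧-no : {P Q : Set} (p : Dec P) (q : Dec Q) (b : Bool) → (P → Q → ⊥) →
                     indicator (does p ∧ (does q ∧ b)) ≡ 0
indicator-dec-∧-no (no _)  _       b _   = refl
indicator-dec-∧-no (yes _) (no _)  b _   = refl
indicator-dec-∧-no (yes p) (yes q) b ¬pq = ⊥-elim (¬pq p q)

indicator-dec-∧-yes : {P Q : Set} (p : Dec P) (q : Dec Q) (b : Bool) → P → Q →
                      indicator (does p ∧ (does q ∧ b)) ≡ indicator b
indicator-dec-∧-yes (yes _) (yes _) b _ _ = refl
indicator-dec-∧-yes (no ¬p) _       b p q = ⊥-elim (¬p p)
indicator-dec-∧-yes (yes _) (no ¬q) b p q = ⊥-elim (¬q q)

true≢false : true ≢ false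
true≢false ()

even-suc : ∀ t → even (suc t) ≡ not (even t)
even-suc zero          = refl
even-suc (suc zero)    = refl
even-suc (suc (suc t)) = even-suc t

even⇒odd-suc : ∀ t → even t ≡ true → even (suc t) ≡ false
even⇒odd-suc t even-t = trans (even-suc t) (cong not even-t)

fwdStep : Bool → Eff
fwdStep b = if b then dec else inc

bwdStep : Bool → Eff
bwdStep b = if b then inc else dec

bwdStep-fwdStep : ∀ b x → (b ≡ true → 1 ≤ x) → apply (bwdStep b) (apply (fwdStep b) x) ≡ x
bwdStep-fwdStep true  (suc x) _   = refl
bwdStep-fwdStep true  zero    1≤0 with 1≤0 refl
... | ()
bwdStep-fwdStep false x       _   = refl

fwdStep-pair : ∀ b x y → (b ≡ true → 1 ≤ x) → (not b ≡ true → 1 ≤ y) →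
               apply (fwdStep b) x + apply (fwdStep (not b)) y ≡ x + y
fwdStep-pair true  (suc x) y       _ _   = +-suc x y
fwdStep-pair true  zero    y       1≤0 _ with 1≤0 refl
... | ()
fwdStep-pair false x       (suc y) _ _   = sym (+-suc x y)
fwdStep-pair false x       zero    _ 1≤0 with 1≤0 refl
... | ()

apply-eff-fwd-0≤ : ∀ l x → apply (eff fwd l 0) x ≤ x
apply-eff-fwd-0≤ l x with even l
... | true  = m∸n≤m x 1
... | false = ≤-refl

<⇒≡ᵇ-false : ∀ {a b} → a < b → (a ≡ᵇ b) ≡ false
<⇒≡ᵇ-false {zero}  {suc b} _         = refl
<⇒≡ᵇ-false {suc a} {suc b} (s≤s a<b) = <⇒≡ᵇ-false a<b

≡ᵇ-refl : ∀ a → (a ≡ᵇ a) ≡ true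
≡ᵇ-refl zero    = refl
≡ᵇ-refl (suc a) = ≡ᵇ-refl a

eff-fwd-even : ∀ l t → even l ≡ true → eff fwd l t ≡ fwdStep (even t)
eff-fwd-even l t even-l rewrite even-l = refl

eff-fwd-odd : ∀ L t → even L ≡ true → eff fwd (suc L) (suc t) ≡ fwdStep (even t)
eff-fwd-odd L t even-L rewrite even-suc L | even-L | even-suc t with even t
... | true  = refl
... | false = refl

eff-fwd-odd-start : ∀ L → even L ≡ true → eff fwd (suc L) 0 ≡ keep
eff-fwd-odd-start L even-L rewrite even-suc L | even-L = refl

eff-bwd-even : ∀ L t → even L ≡ true → eff bwd L t ≡ bwdStep (even t)
eff-bwd-even L t even-L rewrite even-L = refl

eff-bwd-odd : ∀ L t → even L ≡ true → t < L → eff bwd (suc L) t ≡ bwdStep (even t)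
eff-bwd-odd L t even-L t<L rewrite even-suc L | even-L | <⇒≡ᵇ-false t<L = refl

eff-bwd-odd-last : ∀ L → even L ≡ true → eff bwd (suc L) L ≡ keep
eff-bwd-odd-last L even-L rewrite even-suc L | even-L | ≡ᵇ-refl L = refl

-- The forward move on a slime of length l changes the even-length block of offsets
-- δ, …, l − 1 (decrementing at even, incrementing at odd block offsets) and fixes offset 0
-- when l is odd (δ = 1).
record BlockShape (l : ℕ) : Set where
  field
    δ L₂          : ℕ
    l≡δ+L         : l ≡ δ + suc (suc L₂)
    even-L₂       : even L₂ ≡ true
    eff-fwd-block : ∀ t → t < suc (suc L₂) → eff fwd l (δ + t) ≡ fwdStep (even t)
    δ-shape       : δ ≡ 0 ⊎ (δ ≡ 1 × eff fwd l 0 ≡ keep)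

blockShape : ∀ l → 2 ≤ l → BlockShape l
blockShape (suc zero) (s≤s ())
blockShape (suc (suc k)) _ with even k in even-k
... | true = record
  { δ = 0 ; L₂ = k ; l≡δ+L = refl ; even-L₂ = even-k
  ; eff-fwd-block = λ t _ → eff-fwd-even (suc (suc k)) t even-k ; δ-shape = inj₁ refl }
blockShape (suc (suc zero))      _ | false with even-k
... | ()
blockShape (suc (suc (suc k′))) _ | false = record
  { δ = 1 ; L₂ = k′ ; l≡δ+L = refl ; even-L₂ = even-k′
  ; eff-fwd-block = λ t _ → eff-fwd-odd (suc (suc k′)) t even-k′
  ; δ-shape = inj₂ (refl , eff-fwd-odd-start (suc (suc k′)) even-k′) }
  where
  even-k′ : even k′ ≡ true
  even-k′ = not-injective (trans (sym (even-suc k′)) even-k)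

a+b≡m⇒b+c<m⇒0<a : ∀ {a b c m} → a + b ≡ m → b + c < m → 0 < a
a+b≡m⇒b+c<m⇒0<a {zero}  {b} {c} refl b+c<b = ⊥-elim (<-irrefl refl (≤-<-trans (m≤m+n b c) b+c<b))
a+b≡m⇒b+c<m⇒0<a {suc a} _ _ = s≤s z≤n

module _ {n : ℕ} {{_ : NonZero n}} where

  -- Cyclic positions

  toℕ-pos : ∀ x → toℕ (pos {n} x) ≡ x % n
  toℕ-pos x = toℕ-fromℕ< (m%n<n x n)

  %≡⇒pos≡ : ∀ {x y} → x % n ≡ y % n → pos {n} x ≡ pos y
  %≡⇒pos≡ {x} {y} e = toℕ-injective (trans (toℕ-pos x) (trans e (sym (toℕ-pos y))))

  pos≡⇒%≡ : ∀ {x y} → pos {n} x ≡ pos y → x % n ≡ y % n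
  pos≡⇒%≡ {x} {y} e = trans (sym (toℕ-pos x)) (trans (cong toℕ e) (toℕ-pos y))

  pos-toℕ : (i : Fin n) → pos (toℕ i) ≡ i
  pos-toℕ i = toℕ-injective (trans (toℕ-pos (toℕ i)) (m<n⇒m%n≡m (toℕ<n i)))

  pos-% : ∀ x → pos {n} (x % n) ≡ pos x
  pos-% x = %≡⇒pos≡ (m%n%n≡m%n x n)

  pos-+n : ∀ x → pos {n} (x + n) ≡ pos x
  pos-+n x = %≡⇒pos≡ ([m+n]%n≡m%n x n)

  pos-+-congʳ : ∀ {x y} k → pos {n} x ≡ pos y → pos (x + k) ≡ pos (y + k)
  pos-+-congʳ {x} {y} k e = %≡⇒pos≡ (begin
    (x + k) % n                ≡⟨ %-distribˡ-+ x k n ⟩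
    ((x % n) + (k % n)) % n    ≡⟨ cong (λ z → (z + k % n) % n) (pos≡⇒%≡ e) ⟩
    ((y % n) + (k % n)) % n    ≡⟨ %-distribˡ-+ y k n ⟨
    (y + k) % n                ∎)
    where open ≡-Reasoning

  pos-+-congˡ : ∀ {x y} k → pos {n} x ≡ pos y → pos (k + x) ≡ pos (k + y)
  pos-+-congˡ {x} {y} k e = subst₂ (λ a b → pos {n} a ≡ pos b) (+-comm x k) (+-comm y k) (pos-+-congʳ k e)

  pos-suc-cong : ∀ {x y} → pos {n} x ≡ pos y → pos (suc x) ≡ pos (suc y)
  pos-suc-cong = pos-+-congˡ 1

  -- x ∸ 1 would be wrong at x = 0; adding n ∸ 1 subtracts 1 modulo n
  prev : ℕ → ℕ
  prev x = x + (n ∸ 1)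

  pos-suc-prev : ∀ x → pos {n} (suc (prev x)) ≡ pos x
  pos-suc-prev x = trans (cong pos (trans (sym (+-suc x (n ∸ 1))) (cong (x +_) (suc-pred n)))) (pos-+n x)

  pos-suc-injective : ∀ {x y} → pos {n} (suc x) ≡ pos (suc y) → pos x ≡ pos y
  pos-suc-injective {x} {y} e =
    trans (sym (pos-suc-prev x)) (trans (pos-+-congʳ (n ∸ 1) e) (pos-suc-prev y))

  pos-prev-suc : ∀ x → pos {n} (prev (suc x)) ≡ pos x
  pos-prev-suc x = pos-suc-injective (pos-suc-prev (suc x))

  pos-+-cancelʳ : ∀ {x y} k → pos {n} (x + k) ≡ pos (y + k) → pos x ≡ pos y
  pos-+-cancelʳ {x} {y} zero e = subst₂ (λ a b → pos {n} a ≡ pos b) (+-identityʳ x) (+-identityʳ y) e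
  pos-+-cancelʳ {x} {y} (suc k) e =
    pos-+-cancelʳ k (pos-suc-injective (subst₂ (λ a b → pos {n} a ≡ pos b) (+-suc x k) (+-suc y k) e))

  pos-+-cancelˡ : ∀ {x y} k → pos {n} (k + x) ≡ pos (k + y) → pos x ≡ pos y
  pos-+-cancelˡ {x} {y} k e = pos-+-cancelʳ k (subst₂ (λ a b → pos {n} a ≡ pos b) (+-comm k x) (+-comm k y) e)

  pos-+-offset : (i p : Fin n) → pos (toℕ i + offset i p) ≡ p
  pos-+-offset i p = begin
    pos (toℕ i + offset i p)               ≡⟨ pos-+-congˡ (toℕ i) (pos-% (toℕ p + (n ∸ toℕ i))) ⟩
    pos (toℕ i + (toℕ p + (n ∸ toℕ i)))   ≡⟨ cong pos shift ⟩
    pos (toℕ p + n)                        ≡⟨ pos-+n (toℕ p) ⟩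
    pos (toℕ p)                            ≡⟨ pos-toℕ p ⟩
    p                                      ∎
    where
    open ≡-Reasoning
    shift : toℕ i + (toℕ p + (n ∸ toℕ i)) ≡ toℕ p + n
    shift = trans (+-comm (toℕ i) _)
              (trans (+-assoc (toℕ p) _ _) (cong (toℕ p +_) (m∸n+n≡m (<⇒≤ (toℕ<n i)))))

  offset-unique : (i p : Fin n) {r : ℕ} → r < n → pos (toℕ i + r) ≡ p → offset i p ≡ r
  offset-unique i p {r} r<n e = begin
    offset i p       ≡⟨ m<n⇒m%n≡m (m%n<n _ n) ⟨
    offset i p % n   ≡⟨ pos≡⇒%≡ (pos-+-cancelˡ (toℕ i) (trans (pos-+-offset i p) (sym e))) ⟩
    r % n            ≡⟨ m<n⇒m%n≡m r<n ⟩
    r                ∎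
    where open ≡-Reasoning

  pairSum-cong : (h : Fin n → ℕ) {x y : ℕ} → pos {n} x ≡ pos y → pairSum h x ≡ pairSum h y
  pairSum-cong h e = cong₂ _+_ (cong h e) (cong h (pos-suc-cong e))

  mx-tabulate : (h : Fin n → ℕ) → mx h ≡ foldr _⊔_ 0 (tabulate {n = n} (λ i → pairSum h (toℕ i)))
  mx-tabulate h = cong (foldr _⊔_ 0) (map-tabulate {n = n} (λ i → i) (λ i → pairSum h (toℕ i)))

  pairSum≤mx : (h : Fin n → ℕ) (x : ℕ) → pairSum h x ≤ mx h
  pairSum≤mx h x = begin
    pairSum h x                ≡⟨ pairSum-cong h (sym (pos-toℕ (pos x))) ⟩
    pairSum h (toℕ (pos {n} x)) ≤⟨ foldr-⊔-upper {n} (λ i → pairSum h (toℕ i)) (pos x) ⟩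
    _                          ≡⟨ mx-tabulate h ⟨
    mx h                       ∎
    where open ≤-Reasoning

  mx-unique : (h : Fin n → ℕ) {M : ℕ} → (∀ x → pairSum h x ≤ M) → (x₀ : ℕ) → pairSum h x₀ ≡ M → mx h ≡ M
  mx-unique h ≤M x₀ ≡M = ≤-antisym
    (≤-trans (≤-reflexive (mx-tabulate h)) (foldr-⊔-lub {n} _ (λ i → ≤M (toℕ i))))
    (≤-trans (≤-reflexive (sym ≡M)) (pairSum≤mx h x₀))

  mx-attained : (h : Fin n → ℕ) → ∃ λ x → pairSum h x ≡ mx h
  mx-attained h with foldr-⊔-attained {n} (λ i → pairSum h (toℕ i))
  ... | inj₁ ≡0      = 0 , ≤-antisym (pairSum≤mx h 0) (≤-trans (≤-reflexive (trans (mx-tabulate h) ≡0)) z≤n)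
  ... | inj₂ (i , e) = toℕ i , trans e (sym (mx-tabulate h))

  ≮mx⇒≡mx : (h : Fin n → ℕ) {x : ℕ} → ¬ pairSum h x < mx h → pairSum h x ≡ mx h
  ≮mx⇒≡mx h {x} ≮ = ≤-antisym (pairSum≤mx h x) (≮⇒≥ ≮)

  ≢mx⇒<mx : (h : Fin n → ℕ) {x : ℕ} → pairSum h x ≢ mx h → pairSum h x < mx h
  ≢mx⇒<mx h {x} ≢ = ≤∧≢⇒< (pairSum≤mx h x) ≢

  -- Slimes

  module Slime (h : Fin n → ℕ) (i : Fin n) (l : ℕ) (S : IsSlime h i l) where

    2≤len : 2 ≤ l
    2≤len = proj₁ S

    len≤n : l ≤ n
    len≤n = proj₁ (proj₂ S)

    0<len∸1 : 0 < l ∸ 1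
    0<len∸1 = ∸-monoˡ-≤ 1 2≤len

    inner : ∀ {k} → k < l ∸ 1 → pairSum h (toℕ i + k) ≡ mx h
    inner k< = subst (λ z → pairSum h (toℕ i + z) ≡ mx h) (toℕ-fromℕ< k<) (proj₁ (proj₂ (proj₂ S)) (fromℕ< k<))

    inner-at : ∀ {k y} → k < l ∸ 1 → pos (toℕ i + k) ≡ pos y → pairSum h y ≡ mx h
    inner-at k< e = trans (sym (pairSum-cong h e)) (inner k<)

    before : pairSum h (prev (toℕ i)) < mx h
    before = proj₁ (proj₂ (proj₂ (proj₂ S)))

    after : pairSum h (toℕ i + (l ∸ 1)) < mx h
    after = proj₂ (proj₂ (proj₂ (proj₂ S)))

  record InSlime (h : Fin n → ℕ) (x : ℕ) : Set where
    constructor inSlime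
    field
      start   : Fin n
      len     : ℕ
      slime   : IsSlime h start len
      off     : ℕ
      off<len : off < len
      at      : pos {n} (toℕ start + off) ≡ pos x

  record PairInSlime (h : Fin n → ℕ) (x : ℕ) : Set where
    constructor pairInSlime
    field
      start     : Fin n
      len       : ℕ
      slime     : IsSlime h start len
      off       : ℕ
      1+off<len : suc off < len
      at        : pos {n} (toℕ start + off) ≡ pos x

    first : InSlime h x
    first = inSlime start len slime off (<-trans (n<1+n off) 1+off<len) at

    second : InSlime h (suc x)
    second = inSlime start len slime (suc off) 1+off<len (trans (cong pos (+-suc (toℕ start) off)) (pos-suc-cong at))

  InSlime-cong : ∀ {h x y} → pos {n} x ≡ pos y → InSlime h x → InSlime h y
  InSlime-cong x≋y (inSlime i l S r r<l at) = inSlime i l S r r<l (trans at x≋y)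

  PairInSlime-cong : ∀ {h x y} → pos {n} x ≡ pos y → PairInSlime h x → PairInSlime h y
  PairInSlime-cong x≋y (pairInSlime i l S r r<l at) = pairInSlime i l S r r<l (trans at x≋y)

  private
    -- The later-starting of two slimes through x would contain the non-maximal pair
    -- just before the other one.
    prev-start-inside : ∀ {h x} (I J : InSlime h x) → InSlime.off I < InSlime.off J → ⊥
    prev-start-inside {h} {x} (inSlime i l S r _ at) (inSlime i′ l′ S′ r′ r′<l′ at′) r<r′ =
      <⇒≢ (Slime.before h i l S) (Slime.inner-at h i′ l′ S′ k<l′∸1 (pos-+-cancelʳ (suc r) same-pos))
      where
      open ≡-Reasoning
      k = r′ ∸ suc r
      k+1+r≡r′ : k + suc r ≡ r′
      k+1+r≡r′ = m∸n+n≡m r<r′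
      k<l′∸1 : k < l′ ∸ 1
      k<l′∸1 = <-≤-trans (≤-trans (s≤s (m≤m+n k r)) (≤-reflexive (trans (sym (+-suc k r)) k+1+r≡r′)))
                         (<⇒≤pred r′<l′)
      same-pos : pos {n} (toℕ i′ + k + suc r) ≡ pos (prev (toℕ i) + suc r)
      same-pos = begin
        pos (toℕ i′ + k + suc r)         ≡⟨ cong pos (trans (+-assoc (toℕ i′) k (suc r)) (cong (toℕ i′ +_) k+1+r≡r′)) ⟩
        pos (toℕ i′ + r′)                ≡⟨ trans at′ (sym at) ⟩
        pos (toℕ i + r)                  ≡⟨ pos-+-congʳ r (pos-suc-prev (toℕ i)) ⟨
        pos (suc (prev (toℕ i)) + r)     ≡⟨ cong pos (+-suc (prev (toℕ i)) r) ⟨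
        pos (prev (toℕ i) + suc r)       ∎

    shorter-slime : ∀ h i {l l′} → IsSlime h i l → IsSlime h i l′ → l < l′ → ⊥
    shorter-slime h i {l} {l′} S S′ l<l′ =
      <⇒≢ (Slime.after h i l S) (Slime.inner h i l′ S′ (∸-monoˡ-< l<l′ (<⇒≤ (Slime.2≤len h i l S))))

  InSlime-unique : ∀ {h x} (I J : InSlime h x) → InSlime.start I ≡ InSlime.start J × InSlime.len I ≡ InSlime.len J
  InSlime-unique {h} I@(inSlime i l S r _ at) J@(inSlime i′ l′ S′ r′ _ at′) with <-cmp r r′
  ... | tri< r<r′ _ _ = ⊥-elim (prev-start-inside I J r<r′)
  ... | tri> _ _ r′<r = ⊥-elim (prev-start-inside J I r′<r)
  ... | tri≈ _ refl _ = i≡i′ , l≡l′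
    where
    i≡i′ : i ≡ i′
    i≡i′ = trans (sym (pos-toℕ i)) (trans (pos-+-cancelʳ r (trans at (sym at′))) (pos-toℕ i′))
    l≡l′ : l ≡ l′
    l≡l′ with <-cmp l l′ | subst (λ j → IsSlime h j l′) (sym i≡i′) S′
    ... | tri< l<l′ _ _ | S″ = ⊥-elim (shorter-slime h i S S″ l<l′)
    ... | tri≈ _ l≡l′ _ | _  = l≡l′
    ... | tri> _ _ l′<l | S″ = ⊥-elim (shorter-slime h i S″ S l′<l)

  hit-≡0 : ∀ d e (h : Fin n → ℕ) i l p → (IsSlime h i l → offset i p < l → ⊥) → hit d e h i l p ≡ 0
  hit-≡0 d e h i l p ¬in = indicator-dec-∧-no (isSlime? h i l) (offset i p <? l) _ ¬in

  hit-slime : ∀ d e (h : Fin n → ℕ) i l p → IsSlime h i l → offset i p < l →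
              hit d e h i l p ≡ indicator (e (eff d l (offset i p)))
  hit-slime d e h i l p S o = indicator-dec-∧-yes (isSlime? h i l) (offset i p <? l) _ S o

  inSlime-at-offset : ∀ {h} i l (x : ℕ) → IsSlime h i l → offset i (pos x) < l → InSlime h x
  inSlime-at-offset i l x S o = inSlime i l S (offset i (pos x)) o (pos-+-offset i (pos x))

  offset-inSlime : ∀ {h x} (I : InSlime h x) → offset (InSlime.start I) (pos x) ≡ InSlime.off I
  offset-inSlime {h} (inSlime i l S r r<l at) = offset-unique i _ (<-≤-trans r<l (Slime.len≤n h i l S)) at

  count-inSlime : ∀ d e {h x} (I : InSlime h x) → count d e h (pos x) ≡ indicator (e (eff d (InSlime.len I) (InSlime.off I)))
  count-inSlime d e {h} {x} I@(inSlime i l S r r<l at) =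
    trans (sum-allFin-single {n} _ i other-start) (trans (sum-allFin-single {suc n} _ lᶠ other-len) this-slime)
    where
    lᶠ : Fin (suc n)
    lᶠ = fromℕ< (s≤s (Slime.len≤n h i l S))
    other-start : ∀ i′ → i′ ≢ i → sum (map (λ l′ → hit d e h i′ (toℕ l′) (pos x)) (allFin (suc n))) ≡ 0
    other-start i′ i′≢i = sum-allFin-≡0 {suc n} _ λ l′ → hit-≡0 d e h i′ (toℕ l′) (pos x)
      λ S′ o′ → i′≢i (sym (proj₁ (InSlime-unique I (inSlime-at-offset i′ (toℕ l′) x S′ o′))))
    other-len : ∀ l′ → l′ ≢ lᶠ → hit d e h i (toℕ l′) (pos x) ≡ 0
    other-len l′ l′≢lᶠ = hit-≡0 d e h i (toℕ l′) (pos x)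
      λ S′ o′ → l′≢lᶠ (toℕ-injective (trans (sym (proj₂ (InSlime-unique I (inSlime-at-offset i (toℕ l′) x S′ o′))))
                                            (sym (toℕ-fromℕ< _))))
    this-slime : hit d e h i (toℕ lᶠ) (pos x) ≡ indicator (e (eff d l r))
    this-slime rewrite toℕ-fromℕ< (s≤s (Slime.len≤n h i l S)) | sym (offset-inSlime I) =
      hit-slime d e h i l (pos x) S (subst (_< l) (sym (offset-inSlime I)) r<l)

  count-¬inSlime : ∀ d e {h x} → ¬ InSlime h x → count d e h (pos x) ≡ 0
  count-¬inSlime d e {h} {x} ¬I =
    sum-allFin-≡0 {n} _ λ i → sum-allFin-≡0 {suc n} _ λ l →
      hit-≡0 d e h i (toℕ l) (pos x) λ S o → ¬I (inSlime-at-offset i (toℕ l) x S o)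

  migrate-inSlime : ∀ d {h x} (I : InSlime h x) → migrate d h (pos x) ≡ apply (eff d (InSlime.len I) (InSlime.off I)) (h (pos x))
  migrate-inSlime d {h} {x} I =
    trans (cong₂ (λ a b → (h (pos x) + a) ∸ b) (count-inSlime d isInc I) (count-inSlime d isDec I))
      (apply-indicators (eff d (InSlime.len I) (InSlime.off I)) (h (pos x)))

  migrate-¬inSlime : ∀ d {h x} → ¬ InSlime h x → migrate d h (pos x) ≡ h (pos x)
  migrate-¬inSlime d {h} {x} ¬I =
    trans (cong₂ (λ a b → (h (pos x) + a) ∸ b) (count-¬inSlime d isInc ¬I) (count-¬inSlime d isDec ¬I)) (+-identityʳ _)

  prev-pair-inner : ∀ h {x} i l {r} → IsSlime h i l → suc r < l → pos {n} (toℕ i + suc r) ≡ pos x →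
                    pairSum h (prev x) ≡ mx h
  prev-pair-inner h {x} i l {r} S r<l at = Slime.inner-at h i l S (∸-monoˡ-< r<l (s≤s z≤n)) at′
    where
    at′ : pos {n} (toℕ i + r) ≡ pos (prev x)
    at′ = pos-suc-injective (trans (cong pos (sym (+-suc (toℕ i) r))) (trans at (sym (pos-suc-prev x))))

  pairs<mx⇒¬InSlime : ∀ {h x} → pairSum h (prev x) < mx h → pairSum h x < mx h → ¬ InSlime h x
  pairs<mx⇒¬InSlime {h} prev< x< (inSlime i l S zero r<l at)    = <⇒≢ x< (Slime.inner-at h i l S (Slime.0<len∸1 h i l S) at)
  pairs<mx⇒¬InSlime {h} prev< x< (inSlime i l S (suc r) r<l at) = <⇒≢ prev< (prev-pair-inner h i l S r<l at)

  InSlime-prev<mx⇒off≡0 : ∀ {h x} (I : InSlime h x) → pairSum h (prev x) < mx h → InSlime.off I ≡ 0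
  InSlime-prev<mx⇒off≡0 (inSlime i l S zero r<l at)    prev< = refl
  InSlime-prev<mx⇒off≡0 {h} (inSlime i l S (suc r) r<l at) prev< = ⊥-elim (<⇒≢ prev< (prev-pair-inner h i l S r<l at))

  isSlime-between : ∀ h y {t t₂} → suc t < t₂ → t₂ ≤ t + n →
                pairSum h (y + t) < mx h → pairSum h (y + t₂) < mx h →
                (∀ t′ → t < t′ → t′ < t₂ → pairSum h (y + t′) ≡ mx h) →
                IsSlime h (pos (y + suc t)) (t₂ ∸ t)
  isSlime-between h y {t} {t₂} 1+t<t₂ t₂≤t+n t< t₂< inside = 2≤len , len≤n , inner , before , after
    where
    s = toℕ (pos {n} (y + suc t))
    s-shift : ∀ k → pos {n} (s + k) ≡ pos (y + (suc t + k))
    s-shift k = trans (pos-+-congʳ k (pos-toℕ _)) (cong pos (+-assoc y (suc t) k))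
    len≡ : t₂ ∸ t ≡ suc (t₂ ∸ suc t)
    len≡ = +-∸-assoc 1 (<⇒≤ 1+t<t₂)
    2≤len : 2 ≤ t₂ ∸ t
    2≤len = subst (2 ≤_) (sym len≡) (s≤s (m<n⇒0<n∸m 1+t<t₂))
    len≤n : t₂ ∸ t ≤ n
    len≤n = m≤n+o⇒m∸n≤o t₂ t t₂≤t+n
    end : suc t + (t₂ ∸ t ∸ 1) ≡ t₂
    end = trans (cong (λ z → suc t + (z ∸ 1)) len≡) (m+[n∸m]≡n (<⇒≤ 1+t<t₂))
    inner : (k : Fin (t₂ ∸ t ∸ 1)) → pairSum h (s + toℕ k) ≡ mx h
    inner k = trans (pairSum-cong h (s-shift (toℕ k)))
                (inside (suc t + toℕ k) (s≤s (m≤m+n t (toℕ k)))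
                        (<-≤-trans (+-monoʳ-< (suc t) (toℕ<n k)) (≤-reflexive end)))
    before : pairSum h (prev s) < mx h
    before = subst (_< mx h) (pairSum-cong h (pos-suc-injective 1+y+t≋s)) t<
      where
      1+y+t≋s : pos {n} (suc (y + t)) ≡ pos (suc (prev s))
      1+y+t≋s = sym (trans (pos-suc-prev s) (trans (pos-toℕ _) (cong pos (+-suc y t))))
    after : pairSum h (s + (t₂ ∸ t ∸ 1)) < mx h
    after = subst (_< mx h) (pairSum-cong h (sym (trans (s-shift _) (cong (λ z → pos (y + z)) end)))) t₂<

  module NonMaxSearch (h : Fin n → ℕ) (y : ℕ) =
    Search (λ t → pairSum h (y + t) < mx h) (λ t → pairSum h (y + t) <? mx h)

  slime-through-from : ∀ h y {u} → u < n → pairSum h y < mx h → pairSum h (y + u) ≡ mx h → PairInSlime h (y + u)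
  slime-through-from h y {u} u<n y< y+u≡mx
    with NonMaxSearch.lastBefore h y u (subst (λ z → pairSum h z < mx h) (sym (+-identityʳ y)) y<)
       | NonMaxSearch.firstFrom h y (n ∸ u) u (subst (_< mx h) (pairSum-cong h y≋y+n) y<)
    where
    y≋y+n : pos {n} y ≡ pos (y + (u + (n ∸ u)))
    y≋y+n = sym (trans (cong (λ z → pos (y + z)) (m+[n∸m]≡n (<⇒≤ u<n))) (pos-+n y))
  ... | t , t≤u , t< , none-before | t₂ , u≤t₂ , t₂≤n , t₂< , none-after =
    pairInSlime (pos (y + suc t)) (t₂ ∸ t) slime (u ∸ suc t) 1+off<len at
    where
    u≮ : ¬ pairSum h (y + u) < mx h
    u≮ u< = <⇒≢ u< y+u≡mx
    t<u : t < u
    t<u = ≤∧≢⇒< t≤u (λ { refl → u≮ t< })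
    u<t₂ : u < t₂
    u<t₂ = ≤∧≢⇒< u≤t₂ (λ { refl → u≮ t₂< })
    slime : IsSlime h (pos (y + suc t)) (t₂ ∸ t)
    slime = isSlime-between h y (<-≤-trans (s≤s t<u) u<t₂)
              (≤-trans t₂≤n (≤-trans (≤-reflexive (m+[n∸m]≡n (<⇒≤ u<n))) (m≤n+m n t))) t< t₂< inside
      where
      inside : ∀ t′ → t < t′ → t′ < t₂ → pairSum h (y + t′) ≡ mx h
      inside t′ t<t′ t′<t₂ with ≤-total t′ u
      ... | inj₁ t′≤u = ≮mx⇒≡mx h (none-before t′ t<t′ t′≤u)
      ... | inj₂ u≤t′ = ≮mx⇒≡mx h (none-after t′ u≤t′ t′<t₂)
    1+off<len : suc (u ∸ suc t) < t₂ ∸ t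
    1+off<len = subst (_< t₂ ∸ t) (+-∸-assoc 1 t<u) (∸-monoˡ-< u<t₂ (<⇒≤ t<u))
    at : pos {n} (toℕ (pos {n} (y + suc t)) + (u ∸ suc t)) ≡ pos (y + u)
    at = trans (pos-+-congʳ _ (pos-toℕ _)) (cong pos (trans (+-assoc y (suc t) _) (cong (y +_) (m+[n∸m]≡n t<u))))

  slime-through : ∀ h → Valid h → ∀ x → pairSum h x ≡ mx h → PairInSlime h x
  slime-through h valid x x≡mx with ¬∀⟶∃¬ n _ (λ i → pairSum h (toℕ i) ≟ mx h) valid
  ... | y , y≢mx = PairInSlime-cong y+u≋x (slime-through-from h (toℕ y) (m%n<n _ n) (≢mx⇒<mx h y≢mx) (trans (pairSum-cong h y+u≋x) x≡mx))
    where
    y+u≋x : pos {n} (toℕ y + offset y (pos x)) ≡ pos x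
    y+u≋x = pos-+-offset y (pos x)

  PairInSlime-next<mx : ∀ {h y} (P : PairInSlime h y) → pairSum h (suc y) < mx h →
                        pos {n} (toℕ (PairInSlime.start P) + PairInSlime.len P) ≡ pos (suc (suc y))
  PairInSlime-next<mx {h} {y} (pairInSlime i l S r 1+r<l at) next< = ends (m≤n⇒m<n∨m≡n 1+r<l)
    where
    i+1+r≋1+y : pos {n} (toℕ i + suc r) ≡ pos (suc y)
    i+1+r≋1+y = trans (cong pos (+-suc (toℕ i) r)) (pos-suc-cong at)
    ends : suc (suc r) < l ⊎ suc (suc r) ≡ l → pos {n} (toℕ i + l) ≡ pos (suc (suc y))
    ends (inj₁ 2+r<l) = ⊥-elim (<⇒≢ next< (Slime.inner-at h i l S (∸-monoˡ-< 2+r<l (s≤s z≤n)) i+1+r≋1+y))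
    ends (inj₂ refl)  = trans (cong pos (+-suc (toℕ i) (suc r))) (pos-suc-cong i+1+r≋1+y)

  inSlime? : ∀ h → Valid h → ∀ x → Dec (InSlime h x)
  inSlime? h valid x with pairSum h x <? mx h | pairSum h (prev x) <? mx h
  ... | no x≮    | _         = yes (PairInSlime.first (slime-through h valid x (≮mx⇒≡mx h x≮)))
  ... | yes _    | no prev≮  =
    yes (InSlime-cong (pos-suc-prev x) (PairInSlime.second (slime-through h valid (prev x) (≮mx⇒≡mx h prev≮))))
  ... | yes x<   | yes prev< = no (pairs<mx⇒¬InSlime prev< x<)

  migrate≤suc : ∀ d h → Valid h → ∀ x → migrate d h (pos x) ≤ suc (h (pos x))
  migrate≤suc d h valid x with inSlime? h valid x
  ... | yes I = ≤-trans (≤-reflexive (migrate-inSlime d I)) (apply≤suc (eff d (InSlime.len I) (InSlime.off I)) _)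
  ... | no ¬I = ≤-trans (≤-reflexive (migrate-¬inSlime d ¬I)) (n≤1+n _)

  ¬InSlime⇒pairs<mx : ∀ h → Valid h → ∀ {x} → ¬ InSlime h x → pairSum h (prev x) < mx h × pairSum h x < mx h
  ¬InSlime⇒pairs<mx h valid {x} ¬I =
    ≢mx⇒<mx h (λ prev≡ → ¬I (InSlime-cong (pos-suc-prev x) (PairInSlime.second (slime-through h valid (prev x) prev≡)))) ,
    ≢mx⇒<mx h (λ x≡ → ¬I (PairInSlime.first (slime-through h valid x x≡)))

  -- Forward migration of a valid code

  module Forward (f : Fin n → ℕ) (valid : Valid f) where

    m : ℕ
    m = mx f

    g : Fin n → ℕ
    g = φ→ f

    F G : ℕ → ℕ
    F x = f (pos x)
    G x = g (pos x)

    G≤1+F : ∀ x → G x ≤ suc (F x)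
    G≤1+F = migrate≤suc fwd f valid

    G≤F : ∀ {x} → pairSum f (prev x) < m → G x ≤ F x
    G≤F {x} prev< with inSlime? f valid x
    ... | no ¬I = ≤-reflexive (migrate-¬inSlime fwd ¬I)
    ... | yes I@(inSlime _ l _ r _ _) = begin
      G x                        ≡⟨ migrate-inSlime fwd I ⟩
      apply (eff fwd l r) (F x)  ≡⟨ cong (λ r′ → apply (eff fwd l r′) (F x)) (InSlime-prev<mx⇒off≡0 I prev<) ⟩
      apply (eff fwd l 0) (F x)  ≤⟨ apply-eff-fwd-0≤ l (F x) ⟩
      F x                        ∎
      where open ≤-Reasoning

    G≤F-suc : ∀ {x} → pairSum f x < m → G (suc x) ≤ F (suc x)
    G≤F-suc {x} x< = G≤F (subst (_< m) (pairSum-cong f (sym (pos-prev-suc x))) x<)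

    module OnSlime (i : Fin n) (l : ℕ) (S : IsSlime f i l) where
      open BlockShape (blockShape l (Slime.2≤len f i l S)) public
      open Slime f i l S public

      s L : ℕ
      s = toℕ i
      L = suc (suc L₂)

      blk : ℕ → ℕ
      blk t = s + (δ + t)

      blk-suc : ∀ t → suc (blk t) ≡ blk (suc t)
      blk-suc t = sym (trans (cong (s +_) (+-suc δ t)) (+-suc s (δ + t)))

      end next : ℕ
      end  = blk (suc L₂)
      next = blk L

      L≤n : L ≤ n
      L≤n = ≤-trans (m≤n+m L δ) (≤-trans (≤-reflexive (sym l≡δ+L)) len≤n)

      l∸1≡ : l ∸ 1 ≡ δ + suc L₂
      l∸1≡ = trans (cong (_∸ 1) l≡δ+L) (+-∸-assoc δ (s≤s z≤n))

      G-blk : ∀ {t} → t < L → G (blk t) ≡ apply (fwdStep (even t)) (F (blk t))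
      G-blk {t} t<L = trans (migrate-inSlime fwd {f} {blk t} (inSlime i l S (δ + t) δ+t<l refl))
                            (cong (λ e → apply e (F (blk t))) (eff-fwd-block t t<L))
        where
        δ+t<l : δ + t < l
        δ+t<l = subst (δ + t <_) (sym l≡δ+L) (+-monoʳ-< δ t<L)

      F-blk-pair : ∀ {t} → suc t < L → F (blk t) + F (blk (suc t)) ≡ m
      F-blk-pair {t} 1+t<L = trans (cong (λ z → F (blk t) + F z) (sym (blk-suc t)))
                                   (inner (subst (δ + t <_) (sym l∸1≡) (+-monoʳ-< δ (s≤s⁻¹ 1+t<L))))

      end< : pairSum f end < m
      end< = subst (λ z → pairSum f (s + z) < m) l∸1≡ after

      F-blk-period : ∀ {t} → suc (suc t) < L → F (blk t) ≡ F (blk (suc (suc t)))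
      F-blk-period {t} 2+t<L = +-cancelʳ-≡ (F (blk (suc t))) _ _
        (trans (F-blk-pair (<-trans (n<1+n _) 2+t<L))
               (trans (sym (F-blk-pair 2+t<L)) (+-comm (F (blk (suc t))) (F (blk (suc (suc t)))))))

      -- Even block offsets all carry the entry at offset L₂, which exceeds the entry after
      -- the slime since the pair after the block is below m.
      F-blk-even-pos : ∀ {t} → t < L → even t ≡ true → 1 ≤ F (blk t)
      F-blk-even-pos {t} t<L even-t with m≤n⇒m<n∨m≡n (s≤s⁻¹ t<L)
      ... | inj₂ refl = ⊥-elim (true≢false (trans (sym even-t) (even⇒odd-suc L₂ even-L₂)))
      ... | inj₁ t<1+L₂ = from-last (L₂ ∸ t) t (m+[n∸m]≡n (s≤s⁻¹ t<1+L₂)) even-t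
        where
        from-last : ∀ d t → t + d ≡ L₂ → even t ≡ true → 1 ≤ F (blk t)
        from-last zero t t+0≡L₂ _ rewrite +-identityʳ t | t+0≡L₂ = a+b≡m⇒b+c<m⇒0<a (F-blk-pair ≤-refl) end<
        from-last (suc zero) t t+1≡L₂ even-t =
          ⊥-elim (true≢false (trans (sym even-L₂)
                                    (trans (cong even (trans (sym t+1≡L₂) (+-comm t 1))) (even⇒odd-suc t even-t))))
        from-last (suc (suc d)) t t+2+d≡L₂ even-t =
          subst (1 ≤_) (sym (F-blk-period 2+t<L)) (from-last d (suc (suc t)) 2+t+d≡L₂ even-t)
          where
          2+t+d≡L₂ : suc (suc t) + d ≡ L₂
          2+t+d≡L₂ = trans (cong suc (sym (+-suc t d))) (trans (sym (+-suc t (suc d))) t+2+d≡L₂)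
          2+t<L : suc (suc t) < L
          2+t<L = s≤s (s≤s (≤-trans (n≤1+n (suc t)) (subst (suc (suc t) ≤_) 2+t+d≡L₂ (m≤m+n (suc (suc t)) d))))

      G-blk-pair : ∀ {t} → suc t < L → pairSum g (blk t) ≡ m
      G-blk-pair {t} 1+t<L = begin
        pairSum g (blk t)                                          ≡⟨ cong (λ z → G (blk t) + G z) (blk-suc t) ⟩
        G (blk t) + G (blk (suc t))                                ≡⟨ cong₂ _+_ (G-blk t<L) (G-blk 1+t<L) ⟩
        apply (fwdStep (even t)) (F (blk t)) + apply (fwdStep (even (suc t))) (F (blk (suc t)))
          ≡⟨ cong (λ b → apply (fwdStep (even t)) (F (blk t)) + apply (fwdStep b) (F (blk (suc t)))) (even-suc t) ⟩
        apply (fwdStep (even t)) (F (blk t)) + apply (fwdStep (not (even t))) (F (blk (suc t)))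
          ≡⟨ fwdStep-pair (even t) _ _ (F-blk-even-pos t<L) (λ e → F-blk-even-pos 1+t<L (trans (even-suc t) e)) ⟩
        F (blk t) + F (blk (suc t))                                ≡⟨ F-blk-pair 1+t<L ⟩
        m                                                          ∎
        where
        open ≡-Reasoning
        t<L : t < L
        t<L = <-trans (n<1+n _) 1+t<L

      G-blk₀<F-blk₀ : G (blk 0) < F (blk 0)
      G-blk₀<F-blk₀ =
        subst (_< F (blk 0)) (sym (G-blk (s≤s z≤n))) (∸-monoʳ-< (s≤s z≤n) (F-blk-even-pos (s≤s z≤n) refl))

      start-dec : δ ≡ 0 → G s < F s
      start-dec δ≡0 = subst (λ x → G x < F x) (trans (cong (λ d → s + (d + 0)) δ≡0) (+-identityʳ s)) G-blk₀<F-blk₀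

      start-keep : δ ≡ 1 → G s ≡ F s
      start-keep δ≡1 with δ-shape
      ... | inj₁ δ≡0 = ⊥-elim (0≢1+n (trans (sym δ≡0) δ≡1))
      ... | inj₂ (_ , keep-0) =
        trans (migrate-inSlime fwd {f} {s} (inSlime i l S 0 (<-trans (s≤s z≤n) 2≤len) (cong pos (+-identityʳ s))))
              (cong (λ e → apply e (F s)) keep-0)

      start-pair<m : δ ≡ 1 → pairSum g s < m
      start-pair<m δ≡1 = begin-strict
        G s + G (suc s)  ≡⟨ cong₂ _+_ (start-keep δ≡1) (cong G (sym blk₀≡1+s)) ⟩
        F s + G (blk 0)  <⟨ +-monoʳ-< (F s) G-blk₀<F-blk₀ ⟩
        F s + F (blk 0)  ≡⟨ cong (λ z → F s + F z) blk₀≡1+s ⟩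
        pairSum f s      ≡⟨ trans (cong (pairSum f) (sym (+-identityʳ s))) (inner 0<len∸1) ⟩
        m                ∎
        where
        open ≤-Reasoning
        blk₀≡1+s : blk 0 ≡ suc s
        blk₀≡1+s = trans (cong (λ d → s + (d + 0)) δ≡1) (+-comm s 1)

      block-or-start : ∀ r → (∃ λ t → δ + t ≡ r) ⊎ (δ ≡ 1 × r ≡ 0)
      block-or-start r with δ-shape
      ... | inj₁ δ≡0 = inj₁ (r , cong (_+ r) δ≡0)
      block-or-start zero    | inj₂ (δ≡1 , _) = inj₂ (δ≡1 , refl)
      block-or-start (suc r) | inj₂ (δ≡1 , _) = inj₁ (r , cong (_+ r) δ≡1)

      blk≋ : ∀ {r t x} → δ + t ≡ r → pos {n} (s + r) ≡ pos x → pos (blk t) ≡ pos x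
      blk≋ δ+t≡r at = trans (cong (λ z → pos (s + z)) δ+t≡r) at

      offset<len⇒t<L : ∀ {r t} → δ + t ≡ r → r < l → t < L
      offset<len⇒t<L {r} {t} δ+t≡r r<l = +-cancelˡ-< δ t L (subst₂ _<_ (sym δ+t≡r) l≡δ+L r<l)

      offset<len⇒1+t<L : ∀ {r t} → δ + t ≡ r → suc r < l → suc t < L
      offset<len⇒1+t<L {r} {t} δ+t≡r = offset<len⇒t<L (trans (+-suc δ t) (cong suc δ+t≡r))

    G-pair≤m : ∀ x → pairSum g x ≤ m
    G-pair≤m x = by-cases (pairSum f x <? m)
      where
      in-slime : PairInSlime f x → pairSum g x ≤ m
      in-slime (pairInSlime i l S r 1+r<l at) = by-position (block-or-start r)
        where
        open OnSlime i l S
        by-position : (∃ λ t → δ + t ≡ r) ⊎ (δ ≡ 1 × r ≡ 0) → pairSum g x ≤ m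
        by-position (inj₁ (t , δ+t≡r)) =
          ≤-reflexive (trans (pairSum-cong g (sym (blk≋ δ+t≡r at))) (G-blk-pair (offset<len⇒1+t<L δ+t≡r 1+r<l)))
        by-position (inj₂ (δ≡1 , refl)) =
          <⇒≤ (subst (_< m) (pairSum-cong g (trans (cong pos (sym (+-identityʳ s))) at)) (start-pair<m δ≡1))
      by-cases : Dec (pairSum f x < m) → pairSum g x ≤ m
      by-cases (yes x<) = ≤-trans (+-mono-≤ (G≤1+F x) (G≤F-suc x<)) x<
      by-cases (no x≮)  = in-slime (slime-through f valid x (≮mx⇒≡mx f x≮))

    mx-g : mx g ≡ m
    mx-g = from-slime (slime-through f valid _ (proj₂ (mx-attained f)))
      where
      from-slime : ∀ {x} → PairInSlime f x → mx g ≡ m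
      from-slime (pairInSlime i l S _ _ _) = mx-unique g G-pair≤m (blk 0) (G-blk-pair (s≤s (s≤s z≤n)))
        where open OnSlime i l S

    fixed⇒pair<m : ∀ {x} → G x ≡ F x → pairSum f (prev x) < m → pairSum g x < m
    fixed⇒pair<m {x} fixed prev< = by-cases (pairSum f x <? m)
      where
      slime-start : (P : PairInSlime f x) → PairInSlime.off P ≡ 0 → pairSum g x < m
      slime-start (pairInSlime i l S _ _ at) refl = by-shape δ-shape
        where
        open OnSlime i l S
        s≋x : pos {n} s ≡ pos x
        s≋x = trans (cong pos (sym (+-identityʳ s))) at
        by-shape : δ ≡ 0 ⊎ (δ ≡ 1 × eff fwd l 0 ≡ keep) → pairSum g x < m
        by-shape (inj₁ δ≡0)      = ⊥-elim (<⇒≢ (start-dec δ≡0) (trans (cong g s≋x) (trans fixed (cong f (sym s≋x)))))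
        by-shape (inj₂ (δ≡1 , _)) = subst (_< m) (pairSum-cong g s≋x) (start-pair<m δ≡1)
      by-cases : Dec (pairSum f x < m) → pairSum g x < m
      by-cases (yes x<) = ≤-<-trans (+-mono-≤ (≤-reflexive fixed) (G≤F-suc x<)) x<
      by-cases (no x≮)  = slime-start P (InSlime-prev<mx⇒off≡0 (PairInSlime.first P) prev<)
        where P = slime-through f valid x (≮mx⇒≡mx f x≮)

    module Image (i : Fin n) (l : ℕ) (S : IsSlime f i l) where
      open OnSlime i l S

      b₀ : Fin n
      b₀ = pos (blk 0)

      b₀-shift : ∀ k → pos {n} (toℕ b₀ + k) ≡ pos (blk k)
      b₀-shift k = trans (pos-+-congʳ k (pos-toℕ b₀))
                         (cong pos (trans (+-assoc s (δ + 0) k) (cong (λ z → s + (z + k)) (+-identityʳ δ))))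

      before-b₀ : pairSum g (prev (toℕ b₀)) < m
      before-b₀ = subst (_< m) (pairSum-cong g (sym (pos-+-congʳ (n ∸ 1) (pos-toℕ b₀)))) (by-shape δ-shape)
        where
        by-shape : δ ≡ 0 ⊎ (δ ≡ 1 × eff fwd l 0 ≡ keep) → pairSum g (prev (blk 0)) < m
        by-shape (inj₁ δ≡0) = subst (λ z → pairSum g (prev z) < m) (sym blk₀≡s) (begin-strict
          G (prev s) + G (suc (prev s))  ≡⟨ cong (λ z → G (prev s) + g z) (pos-suc-prev s) ⟩
          G (prev s) + G s               ≤⟨ +-monoˡ-≤ (G s) (G≤1+F (prev s)) ⟩
          suc (F (prev s)) + G s         ≡⟨ +-suc (F (prev s)) (G s) ⟨
          F (prev s) + suc (G s)         ≤⟨ +-monoʳ-≤ (F (prev s)) (start-dec δ≡0) ⟩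
          F (prev s) + F s               ≡⟨ cong (λ z → F (prev s) + f z) (pos-suc-prev s) ⟨
          pairSum f (prev s)             <⟨ before ⟩
          m                              ∎)
          where
          open ≤-Reasoning
          blk₀≡s : blk 0 ≡ s
          blk₀≡s = trans (cong (λ d → s + (d + 0)) δ≡0) (+-identityʳ s)
        by-shape (inj₂ (δ≡1 , _)) = subst (_< m) (pairSum-cong g (sym prev-blk₀≋s)) (start-pair<m δ≡1)
          where
          prev-blk₀≋s : pos {n} (prev (blk 0)) ≡ pos s
          prev-blk₀≋s = pos-suc-injective
            (trans (pos-suc-prev (blk 0)) (cong pos (trans (cong (λ d → s + (d + 0)) δ≡1) (+-comm s 1))))

      toImage : ∀ {L′} → 2 ≤ L′ → L′ ≤ n → (∀ {k} → k < L′ ∸ 1 → pairSum g (blk k) ≡ m) →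
                pairSum g (blk (L′ ∸ 1)) < m → IsSlime g b₀ L′
      toImage 2≤L′ L′≤n inner′ after′ =
        2≤L′ , L′≤n ,
        (λ k → trans (pairSum-cong g (b₀-shift (toℕ k))) (trans (inner′ (toℕ<n k)) (sym mx-g))) ,
        subst (pairSum g (prev (toℕ b₀)) <_) (sym mx-g) before-b₀ ,
        subst₂ _<_ (sym (pairSum-cong g (b₀-shift _))) (sym mx-g) after′

      1+end≡next : suc end ≡ next
      1+end≡next = blk-suc (suc L₂)

      prev-next≋end : pos {n} (prev next) ≡ pos end
      prev-next≋end = subst (λ z → pos {n} (prev z) ≡ pos end) 1+end≡next (pos-prev-suc end)

      prev-next< : pairSum f (prev next) < m
      prev-next< = subst (_< m) (pairSum-cong f (sym prev-next≋end)) end<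

      G-end : G end ≡ suc (F end)
      G-end = trans (G-blk (n<1+n _)) (cong (λ b → apply (fwdStep b) (F end)) (even⇒odd-suc L₂ even-L₂))

      end≡m⇒next-fixed : pairSum g end ≡ m → G next ≡ F next
      end≡m⇒next-fixed end≡m = ≤-antisym (G≤F prev-next<) (+-cancelˡ-≤ (F end) _ _ (s≤s⁻¹ (begin-strict
        F end + F next          ≡⟨ cong (λ z → F end + F z) 1+end≡next ⟨
        pairSum f end           <⟨ end< ⟩
        m                       ≡⟨ end≡m ⟨
        G end + G (suc end)     ≡⟨ cong₂ _+_ G-end (cong G 1+end≡next) ⟩
        suc (F end) + G next    ∎)))
        where open ≤-Reasoning

      next-fixed⇒1+L≤n : G next ≡ F next → suc L ≤ n
      next-fixed⇒1+L≤n fixed = by-shape δ-shape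
        where
        by-shape : δ ≡ 0 ⊎ (δ ≡ 1 × eff fwd l 0 ≡ keep) → suc L ≤ n
        by-shape (inj₂ (δ≡1 , _)) = subst (_≤ n) (trans l≡δ+L (cong (_+ L) δ≡1)) len≤n
        by-shape (inj₁ δ≡0) = ≤∧≢⇒< L≤n L≢n
          where
          L≢n : L ≢ n
          L≢n L≡n = <⇒≢ (start-dec δ≡0) (begin
            G s     ≡⟨ cong g next≋s ⟨
            G next  ≡⟨ fixed ⟩
            F next  ≡⟨ cong f next≋s ⟩
            F s     ∎)
            where
            open ≡-Reasoning
            next≋s : pos {n} next ≡ pos s
            next≋s = trans (cong (λ d → pos (s + d)) (trans (cong (_+ L) δ≡0) L≡n)) (pos-+n s)

      image : (pairSum g end < m × IsSlime g b₀ L) ⊎ IsSlime g b₀ (suc L)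
      image = by-cases (pairSum g end <? m)
        where
        by-cases : Dec (pairSum g end < m) → (pairSum g end < m × IsSlime g b₀ L) ⊎ IsSlime g b₀ (suc L)
        by-cases (yes end<) = inj₁ (end< , toImage (s≤s (s≤s z≤n)) L≤n (λ k<1+L₂ → G-blk-pair (s≤s k<1+L₂)) end<)
        by-cases (no end≮)  =
          inj₂ (toImage (s≤s (s≤s z≤n)) (next-fixed⇒1+L≤n fixed) inner′ (fixed⇒pair<m fixed prev-next<))
          where
          end≡m : pairSum g end ≡ m
          end≡m = ≤-antisym (G-pair≤m end) (≮⇒≥ end≮)
          fixed : G next ≡ F next
          fixed = end≡m⇒next-fixed end≡m
          inner′ : ∀ {k} → k < L → pairSum g (blk k) ≡ m
          inner′ k<L with m≤n⇒m<n∨m≡n (s≤s⁻¹ k<L)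
          ... | inj₁ k<1+L₂ = G-blk-pair (s≤s k<1+L₂)
          ... | inj₂ refl   = end≡m

      migrate-bwd-blk : ∀ {t} → t < L → migrate bwd g (pos (blk t)) ≡ apply (bwdStep (even t)) (G (blk t))
      migrate-bwd-blk {t} t<L with image
      ... | inj₁ (_ , S′) = trans (migrate-inSlime bwd {g} {blk t} (inSlime b₀ L S′ t t<L (b₀-shift t)))
                                  (cong (λ e → apply e (G (blk t))) (eff-bwd-even L t even-L₂))
      ... | inj₂ S′       = trans (migrate-inSlime bwd {g} {blk t} (inSlime b₀ (suc L) S′ t (<-trans t<L (n<1+n L)) (b₀-shift t)))
                                  (cong (λ e → apply e (G (blk t))) (eff-bwd-odd L t even-L₂ t<L))

      φ←φ→-blk : ∀ {t} → t < L → migrate bwd g (pos (blk t)) ≡ F (blk t)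
      φ←φ→-blk {t} t<L = begin
        migrate bwd g (pos (blk t))                                   ≡⟨ migrate-bwd-blk t<L ⟩
        apply (bwdStep (even t)) (G (blk t))                          ≡⟨ cong (apply (bwdStep (even t))) (G-blk t<L) ⟩
        apply (bwdStep (even t)) (apply (fwdStep (even t)) (F (blk t))) ≡⟨ bwdStep-fwdStep (even t) _ (F-blk-even-pos t<L) ⟩
        F (blk t)                                                     ∎
        where open ≡-Reasoning

      migrate-bwd-next : pairSum g next < m → migrate bwd g (pos next) ≡ G next
      migrate-bwd-next next< with image
      ... | inj₁ (end< , _) =
        migrate-¬inSlime bwd {g} {next} (pairs<mx⇒¬InSlime prev-next<g (subst (pairSum g next <_) (sym mx-g) next<))
        where
        prev-next<g : pairSum g (prev next) < mx g
        prev-next<g = subst₂ _<_ (pairSum-cong g (sym prev-next≋end)) (sym mx-g) end<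
      ... | inj₂ S′ = trans (migrate-inSlime bwd {g} {next} (inSlime b₀ (suc L) S′ L (n<1+n L) (b₀-shift L)))
                            (cong (λ e → apply e (G next)) (eff-bwd-odd-last L even-L₂))

    -- A position fixed by φ→ lies in a slime of g only as the untouched last entry of an odd one.
    migrate-bwd-fixed : ∀ {x} → G x ≡ F x → pairSum f (prev x) < m → migrate bwd g (pos x) ≡ F x
    migrate-bwd-fixed {x} fixed prev< = trans (by-cases (pairSum f (prev (prev x)) <? m)) fixed
      where
      x< : pairSum g x < m
      x< = fixed⇒pair<m fixed prev<
      after-slime : PairInSlime f (prev (prev x)) → migrate bwd g (pos x) ≡ G x
      after-slime P@(pairInSlime i l S _ _ _) = begin
        migrate bwd g (pos x)     ≡⟨ cong (migrate bwd g) next≋x ⟨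
        migrate bwd g (pos next)  ≡⟨ Image.migrate-bwd-next i l S (subst (_< m) (pairSum-cong g (sym next≋x)) x<) ⟩
        G next                    ≡⟨ cong g next≋x ⟩
        G x                       ∎
        where
        open ≡-Reasoning
        open OnSlime i l S using (s; δ; L; next; l≡δ+L)
        next≋x : pos {n} next ≡ pos x
        next≋x = begin
          pos (s + (δ + L))               ≡⟨ cong (λ z → pos (s + z)) l≡δ+L ⟨
          pos (s + l)                     ≡⟨ PairInSlime-next<mx P (subst (_< m) (pairSum-cong f (sym (pos-suc-prev _))) prev<) ⟩
          pos (suc (suc (prev (prev x)))) ≡⟨ trans (pos-suc-cong (pos-suc-prev (prev x))) (pos-suc-prev x) ⟩
          pos x                           ∎
      by-cases : Dec (pairSum f (prev (prev x)) < m) → migrate bwd g (pos x) ≡ G x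
      by-cases (no prev²≮) = after-slime (slime-through f valid (prev (prev x)) (≮mx⇒≡mx f prev²≮))
      by-cases (yes prev²<) = migrate-¬inSlime bwd {g} {x} (pairs<mx⇒¬InSlime prev<g (subst (pairSum g x <_) (sym mx-g) x<))
        where
        prev<g : pairSum g (prev x) < mx g
        prev<g = begin-strict
          G (prev x) + G (suc (prev x))  ≡⟨ cong (λ z → G (prev x) + g z) (pos-suc-prev x) ⟩
          G (prev x) + G x               ≤⟨ +-monoˡ-≤ (G x) (G≤F prev²<) ⟩
          F (prev x) + G x               ≡⟨ cong (λ z → F (prev x) + z) (trans fixed (cong f (sym (pos-suc-prev x)))) ⟩
          pairSum f (prev x)             <⟨ prev< ⟩
          m                              ≡⟨ mx-g ⟨
          mx g                           ∎
          where open ≤-Reasoning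

    φ←φ→ : ∀ x → migrate bwd g (pos x) ≡ F x
    φ←φ→ x = by-cases (inSlime? f valid x)
      where
      in-slime : InSlime f x → migrate bwd g (pos x) ≡ F x
      in-slime (inSlime i l S r r<l at) = by-position (block-or-start r)
        where
        open OnSlime i l S
        by-position : (∃ λ t → δ + t ≡ r) ⊎ (δ ≡ 1 × r ≡ 0) → migrate bwd g (pos x) ≡ F x
        by-position (inj₁ (t , δ+t≡r)) =
          subst (λ z → migrate bwd g z ≡ f z) (blk≋ δ+t≡r at) (Image.φ←φ→-blk i l S (offset<len⇒t<L δ+t≡r r<l))
        by-position (inj₂ (δ≡1 , refl)) =
          subst (λ z → migrate bwd g z ≡ f z) (trans (cong pos (sym (+-identityʳ s))) at)
                (migrate-bwd-fixed (start-keep δ≡1) before)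
      by-cases : Dec (InSlime f x) → migrate bwd g (pos x) ≡ F x
      by-cases (yes I) = in-slime I
      by-cases (no ¬I) = migrate-bwd-fixed (migrate-¬inSlime fwd ¬I) (proj₁ (¬InSlime⇒pairs<mx f valid ¬I))

lemma2p2 : (n k : ℕ) {{nz : NonZero n}} → 0 < k → (f : Fin n → ℕ) → codeSum f ≡ k → Valid f → (p : Fin n) → φ← (φ→ f) p ≡ f p
lemma2p2 n _ _ f _ valid p = subst (λ q → φ← (φ→ f) q ≡ f q) (pos-toℕ p) (Forward.φ←φ→ f valid (toℕ p))
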